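{- Let $m\ge2$, $k\ge1$, $g\ge0$, $n=m+g(m-1)$, and let $D$ be an $(m-1)$-Dyck path of length $n-1$ with $d(D)=(d_1,\dots,d_n)$. Then $D$ is $k$-minimal if and only if $d_i<k(m-1)$ for all $2\le i\le n$.
   Context: $N$ denotes the unit step $(1,1)$, $S$ the step $(1,-1)$; lattice paths are identified with words in $N,S$. An $(m-1)$-Dyck path is a lattice path from $(0,0)$ with up-steps $(m-1,m-1)$ and down-steps $(1,-1)$, never below the $x$-axis and ending on it; its length is its number of down-steps. Each $(m-1)$-Dyck path $D$ of length $n-1$ is uniquely written $N^{d_1}SN^{d_2}S\dots SN^{d_{n-1}}SN^{d_n}$ with $d_i$ non-negative multiples of $m-1$ and $d_n=0$; $d(D):=(d_1,\dots,d_n)$. Right $k$-compression: replace a consecutive subword $X=N^{m-1}D_1SD_2S\dots D_{j-1}SN^{k(m-1)}D_jSD_{j+1}S\dots SD_{m+k(m-1)}$ ($1\le j\le m-1$, each $D_i$ a possibly empty word that is an $(m-1)$-Dyck path up to translation) by $X'=N^{m-1}D_1S\dots D_{j-1}SD_jSN^{k(m-1)}D_{j+1}S\dots SD_{m+k(m-1)}$. Write $D'\preceq_k D$ if $D$ is obtained from $D'$ by finitely many right $k$-compressions. $D$ is $k$-minimal if there is no $(m-1)$-Dyck path $D'\neq D$ of length $n-1$ with $D'\preceq_k D$. -}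

module Defs where

open import Data.Nat using (ℕ; zero; suc; _+_; _*_; _∸_; _≤_; _<_)
open import Data.List using (List; []; _∷_; _++_; [_]; replicate; length; concatMap; intersperse; concat; drop)
open import Data.List.Relation.Unary.All using (All)
open import Data.Product using (Σ; _×_; ∃-syntax)
open import Relation.Binary.PropositionalEquality using (_≡_; _≢_)
open import Relation.Binary.Construct.Closure.ReflexiveTransitive using (Star)
open import Relation.Nullary using (¬_)

-- Letters: N = unit step (1,1), S = unit step (1,-1).
data Letter : Set where
  N S : Letter

Word : Set
Word = List Letter

-- Walk m h w : the word w, read from height h, is a concatenation of
-- up-steps N^(m-1) and down-steps S, never goes below the x-axis and
-- ends on the x-axis.
data Walk (m : ℕ) : ℕ → Word → Set where
  done : Walk m 0 []
  up   : ∀ {h w} → Walk m (h + (m ∸ 1)) w → Walk m h (replicate (m ∸ 1) N ++ w)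
  down : ∀ {h w} → Walk m h w → Walk m (suc h) (S ∷ w)

IsDyck : ℕ → Word → Set
IsDyck m w = Walk m 0 w

countS : Word → ℕ
countS []      = 0
countS (N ∷ w) = countS w
countS (S ∷ w) = suc (countS w)

DyckPath : ℕ → ℕ → Word → Set
DyckPath m len w = IsDyck m w × countS w ≡ len

-- d(D) = (d_1,...,d_n): lengths of the maximal N-runs separated by the S's,
-- D = N^{d_1} S N^{d_2} S ... S N^{d_n}.
dvec : Word → List ℕ
dvec []      = 0 ∷ []
dvec (N ∷ w) with dvec w
... | []     = 1 ∷ []
... | x ∷ xs = suc x ∷ xs
dvec (S ∷ w) = 0 ∷ dvec w

joinS : List Word → Word
joinS ws = concat (intersperse [ S ] ws)

-- With As = (D_1,…,D_{j-1}),
-- Dj = D_j, Cs = (D_{j+1},…,D_{m+k(m-1)}):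
--   X  = N^{m-1} D_1 S … D_{j-1} S N^{k(m-1)} D_j S D_{j+1} S … S D_{m+k(m-1)}
--   X' = N^{m-1} D_1 S … D_{j-1} S D_j S N^{k(m-1)} D_{j+1} S … S D_{m+k(m-1)}
compX : ℕ → ℕ → List Word → Word → List Word → Word
compX m k As Dj Cs =
  replicate (m ∸ 1) N ++ concatMap (λ A → A ++ [ S ]) As
    ++ replicate (k * (m ∸ 1)) N ++ joinS (Dj ∷ Cs)

compX' : ℕ → ℕ → List Word → Word → List Word → Word
compX' m k As Dj Cs =
  replicate (m ∸ 1) N ++ concatMap (λ A → A ++ [ S ]) As
    ++ Dj ++ [ S ] ++ replicate (k * (m ∸ 1)) N ++ joinS Cs

-- One right k-compression: w ⟶ w'.  Here j = length As + 1, 1 ≤ j ≤ m-1,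
-- and the total number of D_i's is m + k(m-1).
data RightComp (m k : ℕ) : Word → Word → Set where
  rc : (P Q : Word) (As : List Word) (Dj : Word) (Cs : List Word) →
       suc (length As) ≤ m ∸ 1 →
       length As + suc (length Cs) ≡ m + k * (m ∸ 1) →
       All (IsDyck m) As → IsDyck m Dj → All (IsDyck m) Cs →
       RightComp m k (P ++ compX m k As Dj Cs ++ Q) (P ++ compX' m k As Dj Cs ++ Q)

Preceq : ℕ → ℕ → Word → Word → Set
Preceq m k D' D = Star (RightComp m k) D' D

KMinimal : ℕ → ℕ → ℕ → Word → Set
KMinimal m k len D =
  ¬ (Σ Word λ D' → DyckPath m len D' × D' ≢ D × Preceq m k D' D)

-- A right k-compression moves the block N^{k(m-1)} from just before a factor D_j S
-- to just after it, so its result has a run of length ≥ k(m-1) right after an S;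
-- hence a path whose later runs are all short is k-minimal.  Conversely, if
-- D = P S N^{k(m-1)} R, read P backwards from that S, grouping it into Dyck
-- factors each followed by S, until an up-step N^{m-1} is met.  If at most m-1
-- factors were collected, the up-step opens the pattern X', and a first-passage
-- decomposition of R supplies the remaining factors, so D is a compression of some
-- D' ≠ D of the same length.  Otherwise the up-step and the first m factors form a
-- single Dyck factor and the scan continues; since D starts on the x-axis, it
-- cannot run past the beginning of D.
module Submission where

open import Defs
open import Data.Nat using (ℕ; zero; suc; _+_; _*_; _∸_; _≤_; _<_; s≤s; z<s; _<?_; _≤?_)
open import Data.Nat.Properties
  using (+-identityʳ; +-assoc; +-comm; <-irrefl; ≤-trans; +-cancelˡ-≡; +-cancelʳ-≡; suc-injective; m≤m+n; m<m+n; m+[n∸m]≡n;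
         m≢1+n+m; ≰⇒>; ≮⇒≥; <⇒≱; *-mono-≤; ∸-monoˡ-≤)
open import Data.Nat.Solver using (module +-*-Solver)
open import Data.List using (List; []; _∷_; _++_; [_]; _∷ʳ_; replicate; length; concatMap; drop)
open import Data.List.Properties using (++-assoc; ++-cancelˡ; ∷-injectiveʳ; length-++; ++-monoid)
open import Data.List.Relation.Unary.All as All using (All; []; _∷_; all?)
open import Data.List.Relation.Unary.All.Properties using (++⁺; ++⁻; All¬⇒¬Any; ¬All⇒Any¬)
open import Data.List.Relation.Unary.Any as Any using (Any; here; there)
open import Data.Product using (∃; ∃₂; _×_; _,_; map; map₂)
open import Data.Sum using (_⊎_; inj₁; inj₂)
open import Data.Empty using (⊥-elim)
open import Relation.Binary.PropositionalEquality
  using (_≡_; _≢_; refl; sym; trans; cong; subst; subst₂; module ≡-Reasoning)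
open import Relation.Binary.Construct.Closure.ReflexiveTransitive using (Star; ε; _◅_)
open import Relation.Nullary using (yes; no)
open import Function.Bundles using (_⇔_; mk⇔)
import Algebra.Solver.Monoid as MonoidSolver

open +-*-Solver using (_:+_; _:=_; con)
module ++-Solver = MonoidSolver (++-monoid Letter)
open ++-Solver using (_⊕_; _⊜_)

headRun : Word → ℕ
headRun []      = 0
headRun (N ∷ w) = suc (headRun w)
headRun (S ∷ w) = 0

tailRuns : Word → List ℕ
tailRuns []      = []
tailRuns (N ∷ w) = tailRuns w
tailRuns (S ∷ w) = dvec w

dvec≡headRun∷tailRuns : ∀ w → dvec w ≡ headRun w ∷ tailRuns w
dvec≡headRun∷tailRuns []      = refl
dvec≡headRun∷tailRuns (N ∷ w) rewrite dvec≡headRun∷tailRuns w = refl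
dvec≡headRun∷tailRuns (S ∷ w) = refl

drop-1-dvec : ∀ w → drop 1 (dvec w) ≡ tailRuns w
drop-1-dvec w = cong (drop 1) (dvec≡headRun∷tailRuns w)

headRun-replicate : ∀ c w → headRun (replicate c N ++ w) ≡ c + headRun w
headRun-replicate zero    w = refl
headRun-replicate (suc c) w = cong suc (headRun-replicate c w)

headRun-++-S : ∀ x y z → headRun (x ++ S ∷ y) ≡ headRun (x ++ S ∷ z)
headRun-++-S []      y z = refl
headRun-++-S (N ∷ x) y z = cong suc (headRun-++-S x y z)
headRun-++-S (S ∷ x) y z = refl

replicate-prefix : ∀ c w → c ≤ headRun w → ∃ λ R → w ≡ replicate c N ++ R
replicate-prefix zero    w       _         = w , refl
replicate-prefix (suc c) (N ∷ w) (s≤s c≤) = map₂ (cong (N ∷_)) (replicate-prefix c w c≤)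

tailRuns-long⇒split : ∀ c w → Any (c ≤_) (tailRuns w) →
                      ∃₂ λ P R → w ≡ P ++ S ∷ replicate c N ++ R
tailRuns-long⇒split c (N ∷ w) long = map (N ∷_) (map₂ (cong (N ∷_))) (tailRuns-long⇒split c w long)
tailRuns-long⇒split c (S ∷ w) long with subst (Any (c ≤_)) (dvec≡headRun∷tailRuns w) long
... | here  c≤    = [] , map₂ (cong (S ∷_)) (replicate-prefix c w c≤)
... | there long′ = map (S ∷_) (map₂ (cong (S ∷_))) (tailRuns-long⇒split c w long′)

split⇒tailRuns-long : ∀ c P R → Any (c ≤_) (tailRuns (P ++ S ∷ replicate c N ++ R))
split⇒tailRuns-long c [] R
  rewrite dvec≡headRun∷tailRuns (replicate c N ++ R) | headRun-replicate c R = here (m≤m+n c _)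
split⇒tailRuns-long c (N ∷ P) R = split⇒tailRuns-long c P R
split⇒tailRuns-long c (S ∷ P) R
  rewrite dvec≡headRun∷tailRuns (P ++ S ∷ replicate c N ++ R) = there (split⇒tailRuns-long c P R)

countS-replicate : ∀ c w → countS (replicate c N ++ w) ≡ countS w
countS-replicate zero    w = refl
countS-replicate (suc c) w = countS-replicate c w

countS-++-S-replicate : ∀ c V W → countS (V ++ S ∷ W) ≡ countS (V ++ S ∷ replicate c N ++ W)
countS-++-S-replicate c []      W = cong suc (sym (countS-replicate c W))
countS-++-S-replicate c (N ∷ V) W = countS-++-S-replicate c V W
countS-++-S-replicate c (S ∷ V) W = cong suc (countS-++-S-replicate c V W)

countS-jump : ∀ c U V W →
  countS (U ++ replicate c N ++ V ++ S ∷ W) ≡ countS (U ++ V ++ S ∷ replicate c N ++ W)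
countS-jump c []      V W = trans (countS-replicate c _) (countS-++-S-replicate c V W)
countS-jump c (N ∷ U) V W = countS-jump c U V W
countS-jump c (S ∷ U) V W = cong suc (countS-jump c U V W)

jump-≢ : ∀ {c} U V W → 1 ≤ c →
  U ++ replicate c N ++ V ++ S ∷ W ≢ U ++ V ++ S ∷ replicate c N ++ W
jump-≢ {suc c} U V W _ eq = m≢1+n+m (headRun (V ++ S ∷ W)) (sym (begin
  suc c + headRun (V ++ S ∷ W)          ≡⟨ headRun-replicate (suc c) _ ⟨
  headRun (replicate (suc c) N ++ V ++ S ∷ W)
    ≡⟨ cong headRun (++-cancelˡ U _ _ eq) ⟩
  headRun (V ++ S ∷ replicate (suc c) N ++ W) ≡⟨ headRun-++-S V _ W ⟩
  headRun (V ++ S ∷ W)                  ∎))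
  where open ≡-Reasoning

descend : List Word → Word → Word
descend []       y = y
descend (E ∷ Es) y = E ++ S ∷ descend Es y

descend-++ : ∀ Es Fs y → descend (Es ++ Fs) y ≡ descend Es (descend Fs y)
descend-++ []       Fs y = refl
descend-++ (E ∷ Es) Fs y = cong (λ z → E ++ S ∷ z) (descend-++ Es Fs y)

descend-++ʳ : ∀ Es x y → descend Es x ++ y ≡ descend Es (x ++ y)
descend-++ʳ []       x y = refl
descend-++ʳ (E ∷ Es) x y =
  trans (++-assoc E _ y) (cong (λ z → E ++ S ∷ z) (descend-++ʳ Es x y))

concatMap-descend : ∀ Es y → concatMap (λ E → E ++ [ S ]) Es ++ y ≡ descend Es y
concatMap-descend []       y = refl
concatMap-descend (E ∷ Es) y = trans (++-assoc (E ++ [ S ]) _ y)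
  (trans (++-assoc E [ S ] _) (cong (λ z → E ++ S ∷ z) (concatMap-descend Es y)))

joinS-∷ʳ-[] : ∀ Es y → joinS (Es ++ [ [] ]) ++ y ≡ descend Es y
joinS-∷ʳ-[] []           y = refl
joinS-∷ʳ-[] (E ∷ [])     y = ++-assoc E [ S ] y
joinS-∷ʳ-[] (E ∷ F ∷ Es) y =
  trans (++-assoc E _ y) (cong (λ z → E ++ S ∷ z) (joinS-∷ʳ-[] (F ∷ Es) y))

module _ {m k : ℕ} (As : List Word) (Dj : Word) (Cs : List Word) (Q : Word) where
  private
    ups jump cm : Word
    ups  = replicate (m ∸ 1) N
    jump = replicate (k * (m ∸ 1)) N
    cm   = concatMap (λ E → E ++ [ S ]) As

  compX-∷ʳ-[] : compX m k As Dj (Cs ++ [ [] ]) ++ Q ≡ ups ++ descend As (jump ++ descend (Dj ∷ Cs) Q)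
  compX-∷ʳ-[] = begin
    (ups ++ cm ++ jump ++ joinS ((Dj ∷ Cs) ++ [ [] ])) ++ Q
      ≡⟨ ++-Solver.solve 5 (λ u a r j q → (u ⊕ (a ⊕ (r ⊕ j))) ⊕ q ⊜ u ⊕ (a ⊕ (r ⊕ (j ⊕ q))))
           refl ups cm jump (joinS ((Dj ∷ Cs) ++ [ [] ])) Q ⟩
    ups ++ cm ++ jump ++ joinS ((Dj ∷ Cs) ++ [ [] ]) ++ Q
      ≡⟨ cong (λ z → ups ++ cm ++ jump ++ z) (joinS-∷ʳ-[] (Dj ∷ Cs) Q) ⟩
    ups ++ cm ++ jump ++ descend (Dj ∷ Cs) Q
      ≡⟨ cong (ups ++_) (concatMap-descend As _) ⟩
    ups ++ descend As (jump ++ descend (Dj ∷ Cs) Q) ∎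
    where open ≡-Reasoning

  compX′-∷ʳ-[] : compX' m k As Dj (Cs ++ [ [] ]) ++ Q ≡ ups ++ descend As (Dj ++ S ∷ jump ++ descend Cs Q)
  compX′-∷ʳ-[] = begin
    (ups ++ cm ++ Dj ++ [ S ] ++ jump ++ joinS (Cs ++ [ [] ])) ++ Q
      ≡⟨ ++-Solver.solve 7 (λ u a d s r j q → (u ⊕ (a ⊕ (d ⊕ (s ⊕ (r ⊕ j))))) ⊕ q
                                         ⊜ u ⊕ (a ⊕ (d ⊕ (s ⊕ (r ⊕ (j ⊕ q))))))
           refl ups cm Dj [ S ] jump (joinS (Cs ++ [ [] ])) Q ⟩
    ups ++ cm ++ Dj ++ S ∷ jump ++ joinS (Cs ++ [ [] ]) ++ Q
      ≡⟨ cong (λ z → ups ++ cm ++ Dj ++ S ∷ jump ++ z) (joinS-∷ʳ-[] Cs Q) ⟩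
    ups ++ cm ++ Dj ++ S ∷ jump ++ descend Cs Q
      ≡⟨ cong (ups ++_) (concatMap-descend As _) ⟩
    ups ++ descend As (Dj ++ S ∷ jump ++ descend Cs Q) ∎
    where open ≡-Reasoning

walk-cast : ∀ {m h h′ w} → h ≡ h′ → Walk m h w → Walk m h′ w
walk-cast refl p = p

walk-++ : ∀ {m h₁ h₂ x y} → Walk m h₁ x → Walk m h₂ y → Walk m (h₁ + h₂) (x ++ y)
walk-++         done               q = q
walk-++ {m} {_} {h₂} {y = y} (up {h} {w} p) q =
  subst (Walk m (h + h₂)) (sym (++-assoc (replicate (m ∸ 1) N) w y))
    (up (walk-cast (raise h (m ∸ 1) h₂) (walk-++ p q)))
  where
  raise : ∀ h a h₂ → (h + a) + h₂ ≡ (h + h₂) + a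
  raise = +-*-Solver.solve 3 (λ h a h₂ → (h :+ a) :+ h₂ := (h :+ h₂) :+ a) refl
walk-++         (down p)           q = down (walk-++ p q)

walk-descend : ∀ {m h y Es} → All (IsDyck m) Es → Walk m h y → Walk m (length Es + h) (descend Es y)
walk-descend []       q = q
walk-descend (d ∷ ds) q = walk-++ d (down (walk-descend ds q))

replicate-+ : ∀ a b w → replicate (a + b) N ++ w ≡ replicate a N ++ replicate b N ++ w
replicate-+ zero    b w = refl
replicate-+ (suc a) b w = cong (N ∷_) (replicate-+ a b w)

walk-up⁻ : ∀ {m h w} → Walk m h (replicate (m ∸ 1) N ++ w) → Walk m (h + (m ∸ 1)) w
walk-up⁻ {zero}        p = walk-cast (sym (+-identityʳ _)) p
walk-up⁻ {suc zero}    p = walk-cast (sym (+-identityʳ _)) p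
walk-up⁻ {suc (suc a)} p = invert p refl
  where
  invert : ∀ {h u w} → Walk (suc (suc a)) h u → u ≡ replicate (suc a) N ++ w →
           Walk (suc (suc a)) (h + suc a) w
  invert (up {w = w′} p) eq = subst (Walk _ _) (++-cancelˡ (replicate (suc a) N) w′ _ eq) p

walk-ups⁺ : ∀ {m} q {h w} → Walk m (h + q * (m ∸ 1)) w → Walk m h (replicate (q * (m ∸ 1)) N ++ w)
walk-ups⁺         zero    {h} p = walk-cast (+-identityʳ h) p
walk-ups⁺ {m} (suc q) {h} {w} p =
  subst (Walk m h) (sym (replicate-+ (m ∸ 1) (q * (m ∸ 1)) w))
    (up (walk-ups⁺ q (walk-cast (sym (+-assoc h (m ∸ 1) _)) p)))

walk-ups⁻ : ∀ {m} q {h w} → Walk m h (replicate (q * (m ∸ 1)) N ++ w) → Walk m (h + q * (m ∸ 1)) w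
walk-ups⁻         zero    {h} p = walk-cast (sym (+-identityʳ h)) p
walk-ups⁻ {m} (suc q) {h} {w} p =
  walk-cast (+-assoc h (m ∸ 1) _)
    (walk-ups⁻ q (walk-up⁻ (subst (Walk m h) (replicate-+ (m ∸ 1) (q * (m ∸ 1)) w) p)))

split-at : ∀ {A : Set} n (xs : List A) → n < length xs →
           ∃₂ λ ys y → ∃ λ zs → xs ≡ ys ++ y ∷ zs × length ys ≡ n
split-at zero    (x ∷ xs) _         = [] , x , xs , refl , refl
split-at (suc n) (x ∷ xs) (s≤s n<) with split-at n xs n<
... | ys , y , zs , eq , len = x ∷ ys , y , zs , cong (x ∷_) eq , cong suc len

init-last : ∀ {A : Set} (x : A) xs → ∃₂ λ ys y → x ∷ xs ≡ ys ∷ʳ y × length ys ≡ length xs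
init-last x []        = [] , x , refl , refl
init-last x (x′ ∷ xs) with init-last x′ xs
... | ys , y , eq , len = x ∷ ys , y , cong (x ∷_) eq , cong suc len

-- N^{m-1} E₁ S … E_{m-1} S E_m is itself a Dyck path: an up-step absorbs the first m factors.
up-descend : ∀ {m} Es → All (IsDyck m) Es → m ∸ 1 < length Es →
  ∃₂ λ E Es′ → All (IsDyck m) (E ∷ Es′) × length Es ≡ m ∸ 1 + length (E ∷ Es′)
             × (∀ y → replicate (m ∸ 1) N ++ descend Es y ≡ descend (E ∷ Es′) y)
up-descend {m} Es dEs long with split-at (m ∸ 1) Es long
... | F , g , G , refl , lenF with ++⁻ F dEs
...   | dF , dg ∷ dG =
  replicate (m ∸ 1) N ++ descend F g , G ,
  up (walk-cast (trans (+-identityʳ _) lenF) (walk-descend dF dg)) ∷ dG ,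
  trans (length-++ F) (cong (_+ _) lenF) ,
  λ y → begin
    replicate (m ∸ 1) N ++ descend (F ++ g ∷ G) y
      ≡⟨ cong (replicate (m ∸ 1) N ++_) (trans (descend-++ F _ y) (sym (descend-++ʳ F g _))) ⟩
    replicate (m ∸ 1) N ++ descend F g ++ S ∷ descend G y
      ≡⟨ ++-assoc (replicate (m ∸ 1) N) _ _ ⟨
    descend ((replicate (m ∸ 1) N ++ descend F g) ∷ G) y ∎
  where open ≡-Reasoning

first-passage : ∀ {m H w} → Walk m H w → ∀ c h → H ≡ c + h →
  ∃₂ λ Cs rest → All (IsDyck m) Cs × length Cs ≡ c × w ≡ descend Cs rest × Walk m h rest
first-passage p        zero    h refl = [] , _ , [] , refl , refl , p
first-passage (down p) (suc c) h eq
  with first-passage p c h (suc-injective eq)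
... | Cs , rest , dCs , len , refl , q = [] ∷ Cs , rest , done ∷ dCs , cong suc len , refl , q
first-passage {m} (up {H} p) (suc c) h eq
  with first-passage p (m ∸ 1 + suc c) h (trans (cong (_+ (m ∸ 1)) eq) (regroup (suc c) h (m ∸ 1)))
  where
  regroup : ∀ c h a → (c + h) + a ≡ (a + c) + h
  regroup = +-*-Solver.solve 3 (λ c h a → (c :+ h) :+ a := (a :+ c) :+ h) refl
... | Cs , rest , dCs , len , refl , q
  with up-descend Cs dCs (subst (m ∸ 1 <_) (sym len) (m<m+n (m ∸ 1) z<s))
...   | E , Es , dEs , len′ , merge =
  E ∷ Es , rest , dEs , +-cancelˡ-≡ (m ∸ 1) _ _ (trans (sym len′) len) , merge rest , q

replicate-N-++-S : ∀ n {P w X} → replicate n N ++ w ≡ P ++ S ∷ X →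
                   ∃ λ P′ → P ≡ replicate n N ++ P′ × w ≡ P′ ++ S ∷ X
replicate-N-++-S zero              eq = _ , refl , eq
replicate-N-++-S (suc n) {N ∷ P} eq with replicate-N-++-S n (∷-injectiveʳ eq)
... | P′ , refl , eq′ = P′ , refl , eq′

RightComp-prefix : ∀ {m k x y} u → RightComp m k x y → RightComp m k (u ++ x) (u ++ y)
RightComp-prefix u (rc P Q As Dj Cs fits count dAs dDj dCs) =
  subst₂ (RightComp _ _) (++-assoc u P _) (++-assoc u P _) (rc (u ++ P) Q As Dj Cs fits count dAs dDj dCs)

RightComp-jump : ∀ {m k x y} → RightComp m k x y →
  ∃₂ λ U V → ∃ λ W → x ≡ U ++ replicate (k * (m ∸ 1)) N ++ V ++ S ∷ W
                   × y ≡ U ++ V ++ S ∷ replicate (k * (m ∸ 1)) N ++ W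
RightComp-jump {m} {k} (rc P Q As Dj [] fits count _ _ _) = ⊥-elim (no-last-factor m fits count)
  where
  -- D_j is never the last factor, since j ≤ m - 1 < m + k(m - 1).
  no-last-factor : ∀ m {n} → suc n ≤ m ∸ 1 → n + 1 ≢ m + k * (m ∸ 1)
  no-last-factor (suc m) {n} fits eq = <-irrefl refl (≤-trans (m≤m+n (suc m) _)
    (subst (_≤ m) (trans (+-comm 1 n) eq) fits))
RightComp-jump {m} {k} (rc P Q As Dj (C ∷ Cs) _ _ _ _ _) =
  P ++ ups ++ cm , Dj , joinS (C ∷ Cs) ++ Q ,
  ++-Solver.solve 8 (λ p u a r d s j q → p ⊕ ((u ⊕ (a ⊕ (r ⊕ (d ⊕ (s ⊕ j))))) ⊕ q)
                                       ⊜ (p ⊕ (u ⊕ a)) ⊕ (r ⊕ (d ⊕ (s ⊕ (j ⊕ q)))))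
    refl P ups cm jump Dj [ S ] (joinS (C ∷ Cs)) Q ,
  ++-Solver.solve 8 (λ p u a r d s j q → p ⊕ ((u ⊕ (a ⊕ (d ⊕ (s ⊕ (r ⊕ j))))) ⊕ q)
                                       ⊜ (p ⊕ (u ⊕ a)) ⊕ (d ⊕ (s ⊕ (r ⊕ (j ⊕ q)))))
    refl P ups cm jump Dj [ S ] (joinS (C ∷ Cs)) Q
  where
  ups jump cm : Word
  ups  = replicate (m ∸ 1) N
  jump = replicate (k * (m ∸ 1)) N
  cm   = concatMap (λ E → E ++ [ S ]) As

RightComp-countS : ∀ {m k x y} → RightComp m k x y → countS x ≡ countS y
RightComp-countS step with RightComp-jump step
... | U , V , W , refl , refl = countS-jump _ U V W

RightComp-≢ : ∀ {m k x y} → 1 ≤ k * (m ∸ 1) → RightComp m k x y → x ≢ y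
RightComp-≢ pos step with RightComp-jump step
... | U , V , W , refl , refl = jump-≢ U V W pos

RightComp-tailRuns : ∀ {m k x y} → RightComp m k x y → Any (k * (m ∸ 1) ≤_) (tailRuns y)
RightComp-tailRuns step with RightComp-jump step
... | U , V , W , _ , refl =
  subst (λ z → Any _ (tailRuns z)) (++-assoc U V _) (split⇒tailRuns-long _ (U ++ V) W)

suc[m∸1]≡m : ∀ {m n} → m ∸ 1 ≡ suc n → suc (m ∸ 1) ≡ m
suc[m∸1]≡m {suc m} _ = refl

module Decompression (m k : ℕ) where
  private
    A c : ℕ
    A = m ∸ 1
    c = k * A
    ups : Word
    ups = replicate A N

  -- The prefix before the block N^c is scanned from right to left.  In the pending
  -- state, w consists of Dyck factors E, Es, each followed by S, then the block;
  -- no up-step has claimed these factors yet.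
  data Scan (h : ℕ) (w : Word) : Set where
    decompressed : ∀ {w′} → RightComp m k w′ w → Walk m h w′ → Scan h w
    pending      : ∀ {t R} E Es → All (IsDyck m) (E ∷ Es) → h ≡ length (E ∷ Es) + t →
                   w ≡ descend (E ∷ Es) (replicate c N ++ R) → Walk m t (replicate c N ++ R) →
                   Scan h w

  up-opens-pattern : ∀ {h R} As Dj d → All (IsDyck m) As → IsDyck m Dj → A ≡ suc (length As) + d →
          Walk m (d + h) (replicate c N ++ R) →
          Scan h (ups ++ descend As (Dj ++ S ∷ replicate c N ++ R))
  up-opens-pattern {h} As Dj d dAs dDj A≡ walk
    with first-passage (walk-ups⁻ k walk) (c + d) h (regroup d h c)
    where
    regroup : ∀ d h c → (d + h) + c ≡ (c + d) + h
    regroup = +-*-Solver.solve 3 (λ d h c → (d :+ h) :+ c := (c :+ d) :+ h) refl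
  ... | Cs , rest , dCs , lenCs , refl , restWalk =
    decompressed (subst₂ (RightComp m k) (compX-∷ʳ-[] {m} {k} As Dj Cs rest)
                                         (compX′-∷ʳ-[] {m} {k} As Dj Cs rest) step)
                 (up climb)
    where
    open ≡-Reasoning
    fits : suc (length As) ≤ A
    fits = subst (suc (length As) ≤_) (sym A≡) (m≤m+n _ d)
    count : length As + suc (length (Cs ++ [ [] ])) ≡ m + c
    count = begin
      length As + suc (length (Cs ++ [ [] ]))  ≡⟨ cong (λ l → length As + suc l) (length-++ Cs) ⟩
      length As + suc (length Cs + 1)          ≡⟨ cong (λ l → length As + suc (l + 1)) lenCs ⟩
      length As + suc ((c + d) + 1)            ≡⟨ +-*-Solver.solve 3 (λ a c d → a :+ (con 1 :+ ((c :+ d) :+ con 1))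
                                                      := (con 1 :+ ((con 1 :+ a) :+ d)) :+ c) refl (length As) c d ⟩
      suc (suc (length As) + d) + c            ≡⟨ cong (λ a → suc a + c) A≡ ⟨
      suc A + c                                ≡⟨ cong (_+ c) (suc[m∸1]≡m A≡) ⟩
      m + c                                    ∎
    step : RightComp m k (compX m k As Dj (Cs ++ [ [] ]) ++ rest) (compX' m k As Dj (Cs ++ [ [] ]) ++ rest)
    step = rc [] rest As Dj (Cs ++ [ [] ]) fits count dAs dDj (++⁺ dCs (done ∷ []))
    afterBlock : Walk m ((suc d + h) + c) (descend (Dj ∷ Cs) rest)
    afterBlock = walk-cast
      (trans (cong (λ l → suc l + h) lenCs)
             (+-*-Solver.solve 3 (λ c d h → con 1 :+ (c :+ d) :+ h := ((con 1 :+ d) :+ h) :+ c) refl c d h))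
      (walk-descend (dDj ∷ dCs) restWalk)
    climb : Walk m (h + A) (descend As (replicate c N ++ descend (Dj ∷ Cs) rest))
    climb = walk-cast
      (trans (+-*-Solver.solve 3 (λ a d h → a :+ ((con 1 :+ d) :+ h) := h :+ ((con 1 :+ a) :+ d)) refl (length As) d h)
             (cong (h +_) (sym A≡)))
      (walk-descend dAs (walk-ups⁺ k afterBlock))

  absorb-up : ∀ {h w} → Scan (h + A) w → Scan h (ups ++ w)
  absorb-up (decompressed step walk) = decompressed (RightComp-prefix ups step) (up walk)
  absorb-up {h} (pending {t} E Es dEs height refl walk) with length (E ∷ Es) ≤? A
  ... | yes fits with init-last E Es
  ...   | As , Dj , eq , lenAs with ++⁻ As (subst (All (IsDyck m)) eq dEs)
  ...     | dAs , dDj ∷ [] =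
    subst (λ z → Scan h (ups ++ z))
      (trans (sym (descend-++ As [ Dj ] _)) (cong (λ L → descend L _) (sym eq)))
      (up-opens-pattern As Dj d dAs dDj (trans A≡ (cong (λ n → suc n + d) (sym lenAs)))
             (walk-cast t≡d+h walk))
    where
    d : ℕ
    d = A ∸ length (E ∷ Es)
    A≡ : A ≡ length (E ∷ Es) + d
    A≡ = sym (m+[n∸m]≡n fits)
    t≡d+h : t ≡ d + h
    t≡d+h = +-cancelˡ-≡ (length (E ∷ Es)) _ _ (trans (sym height) (trans (cong (h +_) A≡)
      (+-*-Solver.solve 3 (λ h l d → h :+ (l :+ d) := l :+ (d :+ h)) refl h (length (E ∷ Es)) d)))
  absorb-up {h} (pending {t} E Es dEs height refl walk) | no long
    with up-descend (E ∷ Es) dEs (≰⇒> long)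
  ... | E′ , Es′ , dEs′ , len , merge = pending E′ Es′ dEs′ h≡ (merge _) walk
    where
    l′ : ℕ
    l′ = length (E′ ∷ Es′)
    h≡ : h ≡ l′ + t
    h≡ = +-cancelʳ-≡ A h (l′ + t) (trans height (trans (cong (_+ t) len)
      (+-*-Solver.solve 3 (λ a l t → (a :+ l) :+ t := (l :+ t) :+ a) refl A l′ t)))

  scan : ∀ {h w} → Walk m h w → ∀ P R → w ≡ P ++ S ∷ replicate c N ++ R → Scan h w
  scan (down p) []      R refl = pending [] [] (done ∷ []) refl refl p
  scan (down p) (S ∷ P) R refl with scan p P R refl
  ... | decompressed step walk = decompressed (RightComp-prefix [ S ] step) (down walk)
  ... | pending E Es dEs height eq walk =
    pending [] (E ∷ Es) (done ∷ dEs) (cong suc height) (cong (S ∷_) eq) walk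
  scan (up p) P R eq with replicate-N-++-S A eq
  ... | P′ , refl , eq′ = absorb-up (scan p P′ R eq′)

  decompress : ∀ {P R} → IsDyck m (P ++ S ∷ replicate c N ++ R) →
               ∃ λ D′ → RightComp m k D′ (P ++ S ∷ replicate c N ++ R) × IsDyck m D′
  decompress {P} {R} dyck with scan dyck P R refl
  ... | decompressed step walk = _ , step , walk

Star-last : ∀ {A : Set} {R : A → A → Set} {x y} → Star R x y → x ≡ y ⊎ ∃ λ z → R z y
Star-last ε = inj₁ refl
Star-last {x = x} (step ◅ steps) with Star-last steps
... | inj₁ refl = inj₂ (x , step)
... | inj₂ last = inj₂ last

shortRuns⇒kMinimal : ∀ {m k len D} → All (_< k * (m ∸ 1)) (drop 1 (dvec D)) → KMinimal m k len D
shortRuns⇒kMinimal {D = D} short (D′ , _ , D′≢D , D′⪯D) with Star-last D′⪯D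
... | inj₁ D′≡D        = D′≢D D′≡D
... | inj₂ (_ , step) =
  All¬⇒¬Any (All.map <⇒≱ (subst (All _) (drop-1-dvec D) short)) (RightComp-tailRuns step)

kMinimal⇒shortRuns : ∀ {m k len D} → 1 ≤ k * (m ∸ 1) → DyckPath m len D → KMinimal m k len D →
                     All (_< k * (m ∸ 1)) (drop 1 (dvec D))
kMinimal⇒shortRuns {m} {k} {D = D} pos (dyck , len) minimal
  with all? (_<? k * (m ∸ 1)) (drop 1 (dvec D))
... | yes short = short
... | no ¬short
  with tailRuns-long⇒split _ D
         (subst (Any _) (drop-1-dvec D) (Any.map ≮⇒≥ (¬All⇒Any¬ (_<? _) _ ¬short)))
... | P , R , refl with Decompression.decompress m k dyck
...   | D′ , step , dyck′ =
  ⊥-elim (minimal (D′ , (dyck′ , trans (RightComp-countS step) len) , RightComp-≢ pos step , step ◅ ε))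

proposition3p13 : (m k g : ℕ) → 2 ≤ m → 1 ≤ k →
    (D : Word) → DyckPath m ((m + g * (m ∸ 1)) ∸ 1) D →
    (KMinimal m k ((m + g * (m ∸ 1)) ∸ 1) D ⇔ All (λ di → di < k * (m ∸ 1)) (drop 1 (dvec D)))
proposition3p13 m k g 2≤m 1≤k D path =
  mk⇔ (kMinimal⇒shortRuns (*-mono-≤ 1≤k (∸-monoˡ-≤ 1 2≤m)) path) shortRuns⇒kMinimal
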